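{- Let $q=p^e$ with $p$ prime. There exist pairwise distinct $a,b,c\in\mathbb{F}_q$ such that $|M_{3,1,3}(a^2,b^2,c^2)|=0$ if and only if $p$ is odd.
   Context: For $u,v,w\in\mathbb{F}_q$, $M_{3,1,3}(u,v,w)$ is the $3\times 3$ matrix with rows $(u^k,v^k,w^k)$ for $k\in\{0,1,2,3,4\}\setminus\{1,3\}=\{0,2,4\}$, and $|\cdot|$ denotes its determinant. -}

module Defs where

open import Level using (_⊔_)
open import Data.Nat using (ℕ)
open import Data.Fin using (Fin; zero; suc)
open import Data.Product using (∃)
open import Relation.Nullary using (¬_)
open import Algebra.Bundles using (CommutativeRing; Semiring)
import Algebra.Definitions.RawSemiring as RawSemiringDefs

record IsField {c ℓ} (F : CommutativeRing c ℓ) : Set (c ⊔ ℓ) where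
  open CommutativeRing F hiding (zero)
  field
    1≉0     : ¬ (1# ≈ 0#)
    inverse : ∀ x → ¬ (x ≈ 0#) → ∃ λ y → (x * y) ≈ 1#

module _ {c ℓ} (F : CommutativeRing c ℓ) where
  open CommutativeRing F hiding (zero)
  open RawSemiringDefs (Semiring.rawSemiring semiring) using (_^_)

  det3 : (Fin 3 → Fin 3 → Carrier) → Carrier
  det3 m =
      m zero zero * (m (suc zero) (suc zero) * m (suc (suc zero)) (suc (suc zero)))
    - m zero zero * (m (suc zero) (suc (suc zero)) * m (suc (suc zero)) (suc zero))
    - m zero (suc zero) * (m (suc zero) zero * m (suc (suc zero)) (suc (suc zero)))
    + m zero (suc zero) * (m (suc zero) (suc (suc zero)) * m (suc (suc zero)) zero)
    + m zero (suc (suc zero)) * (m (suc zero) zero * m (suc (suc zero)) (suc zero))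
    - m zero (suc (suc zero)) * (m (suc zero) (suc zero) * m (suc (suc zero)) zero)

  -- exponents {0,1,2,3,4} \ {1,3} = {0,2,4}
  exps313 : Fin 3 → ℕ
  exps313 zero = 0
  exps313 (suc zero) = 2
  exps313 (suc (suc zero)) = 4

  M313 : Carrier → Carrier → Carrier → Fin 3 → Fin 3 → Carrier
  M313 u v w i zero = u ^ exps313 i
  M313 u v w i (suc zero) = v ^ exps313 i
  M313 u v w i (suc (suc zero)) = w ^ exps313 i

  detM313sq : Carrier → Carrier → Carrier → Carrier
  detM313sq a b c = det3 (M313 (a ^ 2) (b ^ 2) (c ^ 2))

-- |M₃,₁,₃(u,v,w)| is the Vandermonde determinant of u², v², w², so |M₃,₁,₃(a²,b²,c²)| is
-- (b⁴ - a⁴)(c⁴ - a⁴)(c⁴ - b⁴). Translation by 1 permutes 𝔽_q, so q · 1 = 0. If p is odd this forces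
-- 2 · 1 ≠ 0, hence 1 ≠ -1 while 1⁴ = (-1)⁴, and (1, -1, 0) is a solution. If p = 2, then 2 · 1 = 0
-- (otherwise q · 1 = (2 · 1)ᵉ ≠ 0), so squaring is injective and no factor vanishes for distinct a, b, c.
module Submission where

open import Defs
open import Algebra.Bundles using (AbelianGroup; CommutativeRing)
open import Data.Nat as ℕ using (ℕ)
open import Data.Nat.Divisibility using (_∣_; ∣1⇒≡1; _∣0; ∣-refl; ∣m∣n⇒∣m+n)
open import Data.Nat.Primality using (Prime; prime[2]; ¬prime[1]; euclidsLemma; prime⇒irreducible)
open import Data.Fin using (Fin)
import Data.Fin.Permutation as Perm
open import Data.Product using (_,_)
open import Data.Sum using (inj₁; inj₂)
open import Data.Vec.Functional using (replicate)
open import Function.Base using (_∘_)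
open import Function.Bundles using (Inverse)
open import Relation.Nullary using (¬_; contradiction)
import Relation.Binary.PropositionalEquality as ≡

prime∤m⇒prime∤m^n : ∀ {q m} → Prime q → ¬ q ∣ m → ∀ n → ¬ q ∣ m ℕ.^ n
prime∤m⇒prime∤m^n q-prime q∤m ℕ.zero q∣1 = ¬prime[1] (≡.subst Prime (∣1⇒≡1 q∣1) q-prime)
prime∤m⇒prime∤m^n {m = m} q-prime q∤m (ℕ.suc n) q∣m^[1+n]
  with euclidsLemma m (m ℕ.^ n) q-prime q∣m^[1+n]
... | inj₁ q∣m   = q∤m q∣m
... | inj₂ q∣m^n = prime∤m⇒prime∤m^n q-prime q∤m n q∣m^n

2∣prime⇒≡2 : ∀ {p} → Prime p → 2 ∣ p → p ≡.≡ 2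
2∣prime⇒≡2 p-prime 2∣p with prime⇒irreducible p-prime 2∣p
... | inj₂ p≡2 = ≡.sym p≡2

module _ {c ℓ} (G : AbelianGroup c ℓ) where
  open AbelianGroup G
  open import Algebra.Definitions.RawMonoid rawMonoid using (_×_)
  open import Algebra.Properties.CommutativeMonoid.Sum commutativeMonoid
    using (sum; sum-permute; sum-cong-≋; ∑-distrib-+; sum-replicate)
  open import Algebra.Properties.Group group using (identityʳ-unique)
  open import Relation.Binary.Reasoning.Setoid setoid

  module _ {n} (I : Inverse (≡.setoid (Fin n)) setoid) where
    open Inverse I using (to; from; from-cong; strictlyInverseˡ; strictlyInverseʳ)

    shift : Carrier → Fin n → Fin n
    shift g i = from (to i ∙ g)

    shift-shift : ∀ {g h} → g ∙ h ≈ ε → ∀ i → shift h (shift g i) ≡.≡ i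
    shift-shift {g} {h} g∙h≈ε i = ≡.trans (from-cong (begin
      to (shift g i) ∙ h  ≈⟨ ∙-congʳ (strictlyInverseˡ (to i ∙ g)) ⟩
      (to i ∙ g) ∙ h      ≈⟨ assoc (to i) g h ⟩
      to i ∙ (g ∙ h)      ≈⟨ ∙-congˡ g∙h≈ε ⟩
      to i ∙ ε            ≈⟨ identityʳ (to i) ⟩
      to i                ∎)) (strictlyInverseʳ i)

    translation : Carrier → Perm.Permutation n n
    translation g = Perm.permutation (shift g) (shift (g ⁻¹))
      (shift-shift (inverseˡ g)) (shift-shift (inverseʳ g))

    -- Translating by g permutes the elements, so their sum s satisfies s ∙ n × g ≈ s.
    card×x≈ε : ∀ g → n × g ≈ ε
    card×x≈ε g = identityʳ-unique (sum to) (n × g) (begin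
      sum to ∙ n × g                ≈⟨ ∙-congˡ (sym (sum-replicate n)) ⟩
      sum to ∙ sum (replicate n g)  ≈⟨ sym (∑-distrib-+ to (replicate n g)) ⟩
      sum (λ i → to i ∙ g)          ≈⟨ sum-cong-≋ (λ i → sym (strictlyInverseˡ (to i ∙ g))) ⟩
      sum (λ i → to (shift g i))    ≈⟨ sym (sum-permute to (translation g)) ⟩
      sum to                        ∎)

module _ {c ℓ} (R : CommutativeRing c ℓ) where
  open CommutativeRing R
  open import Algebra.Properties.Ring ring
    using ( -‿+-comm; ⁻¹-anti-homo‿-; x[y-z]≈xy-xz; [y-z]x≈yx-zx; -‿distribˡ-*; -‿distribʳ-*
          ; -‿involutive; x≈y⇒x∙y⁻¹≈ε; x∙y⁻¹≈ε⇒x≈y; +-inverseʳ-unique; -0#≈0#)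
  open import Algebra.Properties.Semiring.Exp semiring using (_^_; ^-congˡ)
  open import Algebra.Properties.Semiring.Mult semiring using (_×_; ×-homo-1; ×-homo-+; ×1-homo-*)
  open import Algebra.Solver.Ring.NaturalCoefficients.Default commutativeSemiring
    using (solve; _:+_; _:*_; _:^_; con; _:=_)
  open import Relation.Binary.Reasoning.Setoid setoid

  [a-b]+[c-d]≈[a+c]-[b+d] : ∀ a b c d → (a - b) + (c - d) ≈ (a + c) - (b + d)
  [a-b]+[c-d]≈[a+c]-[b+d] a b c d = begin
    (a - b) + (c - d)    ≈⟨ solve 4 (λ a b′ c d′ → (a :+ b′) :+ (c :+ d′) := (a :+ c) :+ (b′ :+ d′))
                              refl a (- b) c (- d) ⟩
    (a + c) + (- b - d)  ≈⟨ +-congˡ (-‿+-comm b d) ⟩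
    (a + c) - (b + d)    ∎

  [a-b]-[c-d]≈[a+d]-[b+c] : ∀ a b c d → (a - b) - (c - d) ≈ (a + d) - (b + c)
  [a-b]-[c-d]≈[a+d]-[b+c] a b c d = begin
    (a - b) - (c - d)  ≈⟨ +-congˡ (⁻¹-anti-homo‿- c d) ⟩
    (a - b) + (d - c)  ≈⟨ [a-b]+[c-d]≈[a+c]-[b+d] a b d c ⟩
    (a + d) - (b + c)  ∎

  a+d≈c+b⇒a-b≈c-d : ∀ {a b c d} → a + d ≈ c + b → a - b ≈ c - d
  a+d≈c+b⇒a-b≈c-d {a} {b} {c} {d} a+d≈c+b = begin
    a - b              ≈⟨ sym (+-identityʳ (a - b)) ⟩
    (a - b) + 0#       ≈⟨ +-congˡ (sym (-‿inverseʳ d)) ⟩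
    (a - b) + (d - d)  ≈⟨ [a-b]+[c-d]≈[a+c]-[b+d] a b d d ⟩
    (a + d) - (b + d)  ≈⟨ +-cong a+d≈c+b (-‿cong (+-comm b d)) ⟩
    (c + b) - (d + b)  ≈⟨ [a-b]+[c-d]≈[a+c]-[b+d] c d b b ⟨
    (c - d) + (b - b)  ≈⟨ +-congˡ (-‿inverseʳ b) ⟩
    (c - d) + 0#       ≈⟨ +-identityʳ (c - d) ⟩
    c - d              ∎

  [a-b]*[c-d]≈[ac+bd]-[ad+bc] : ∀ a b c d → (a - b) * (c - d) ≈ (a * c + b * d) - (a * d + b * c)
  [a-b]*[c-d]≈[ac+bd]-[ad+bc] a b c d = begin
    (a - b) * (c - d)                  ≈⟨ [y-z]x≈yx-zx (c - d) a b ⟩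
    a * (c - d) - b * (c - d)          ≈⟨ +-cong (x[y-z]≈xy-xz a c d) (-‿cong (x[y-z]≈xy-xz b c d)) ⟩
    (a * c - a * d) - (b * c - b * d)  ≈⟨ [a-b]-[c-d]≈[a+d]-[b+c] _ _ _ _ ⟩
    (a * c + b * d) - (a * d + b * c)  ∎

  det3-signs-regroup : ∀ a b c d e f → ((((a - b) - c) + d) + e) - f ≈ ((a + d) + e) - ((b + c) + f)
  det3-signs-regroup a b c d e f = begin
    ((((a - b) - c) + d) + e) - f    ≈⟨ solve 6 (λ a b′ c′ d e f′ →
           ((((a :+ b′) :+ c′) :+ d) :+ e) :+ f′ := ((a :+ d) :+ e) :+ ((b′ :+ c′) :+ f′))
           refl a (- b) (- c) d e (- f) ⟩
    ((a + d) + e) + ((- b - c) - f)  ≈⟨ +-congˡ (+-congʳ (-‿+-comm b c)) ⟩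
    ((a + d) + e) + (- (b + c) - f)  ≈⟨ +-congˡ (-‿+-comm (b + c) f) ⟩
    ((a + d) + e) - ((b + c) + f)    ∎

  -- The rows u⁰, u², u⁴ make M₃,₁,₃(u,v,w) the Vandermonde matrix of u², v², w².
  det3-M313≈vandermonde : ∀ u v w →
    det3 R (M313 R u v w) ≈ (v ^ 2 - u ^ 2) * ((w ^ 2 - u ^ 2) * (w ^ 2 - v ^ 2))
  det3-M313≈vandermonde u v w = begin
    det3 R (M313 R u v w)                  ≈⟨ det3-signs-regroup _ _ _ _ _ _ ⟩
    _ - _                                  ≈⟨ a+d≈c+b⇒a-b≈c-d (solve 3 (λ u v w →
          let X = u :^ 2; Y = v :^ 2; Z = w :^ 2 in
          ((con 1 :* (Y :* w :^ 4) :+ con 1 :* (Z :* u :^ 4)) :+ con 1 :* (X :* v :^ 4))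
          :+ (Y :* (Z :* Y :+ X :* Z) :+ X :* (Z :* Z :+ X :* Y))
          := (Y :* (Z :* Z :+ X :* Y) :+ X :* (Z :* Y :+ X :* Z))
          :+ ((con 1 :* (Z :* v :^ 4) :+ con 1 :* (X :* w :^ 4)) :+ con 1 :* (Y :* u :^ 4)))
          refl u v w) ⟩
    (Y * Q⁺ + X * Q⁻) - (Y * Q⁻ + X * Q⁺)  ≈⟨ [a-b]*[c-d]≈[ac+bd]-[ad+bc] Y X Q⁺ Q⁻ ⟨
    (Y - X) * (Q⁺ - Q⁻)                    ≈⟨ *-congˡ ([a-b]*[c-d]≈[ac+bd]-[ad+bc] Z X Z Y) ⟨
    (Y - X) * ((Z - X) * (Z - Y))          ∎
    where
    X = u ^ 2
    Y = v ^ 2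
    Z = w ^ 2
    Q⁺ = Z * Z + X * Y
    Q⁻ = Z * Y + X * Z

  -x^2≈x^2 : ∀ x → (- x) ^ 2 ≈ x ^ 2
  -x^2≈x^2 x = begin
    (- x) ^ 2      ≈⟨ *-congˡ (*-identityʳ (- x)) ⟩
    - x * - x      ≈⟨ -‿distribˡ-* x (- x) ⟨
    - (x * - x)    ≈⟨ -‿cong (-‿distribʳ-* x x) ⟨
    - - (x * x)    ≈⟨ -‿involutive (x * x) ⟩
    x * x          ≈⟨ *-congˡ (*-identityʳ x) ⟨
    x ^ 2          ∎

  detM313sq[x,-x,y]≈0 : ∀ x y → detM313sq R x (- x) y ≈ 0#
  detM313sq[x,-x,y]≈0 x y = begin
    detM313sq R x (- x) y                ≈⟨ det3-M313≈vandermonde (x ^ 2) ((- x) ^ 2) (y ^ 2) ⟩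
    (((- x) ^ 2) ^ 2 - (x ^ 2) ^ 2) * _  ≈⟨ *-congʳ (x≈y⇒x∙y⁻¹≈ε (^-congˡ 2 (-x^2≈x^2 x))) ⟩
    0# * _                               ≈⟨ zeroˡ _ ⟩
    0#                                   ∎

  ×1-homo-^ : ∀ m n → (m ℕ.^ n) × 1# ≈ (m × 1#) ^ n
  ×1-homo-^ m ℕ.zero    = ×-homo-1 1#
  ×1-homo-^ m (ℕ.suc n) = begin
    (m ℕ.* m ℕ.^ n) × 1#          ≈⟨ ×1-homo-* m (m ℕ.^ n) ⟩
    (m × 1#) * ((m ℕ.^ n) × 1#)   ≈⟨ *-congˡ (×1-homo-^ m n) ⟩
    (m × 1#) * (m × 1#) ^ n       ∎

  module _ (2×1≈0 : 2 × 1# ≈ 0#) where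

    x+x≈0 : ∀ x → x + x ≈ 0#
    x+x≈0 x = begin
      x + x           ≈⟨ solve 1 (λ x → x :+ x := (con 1 :+ (con 1 :+ con 0)) :* x) refl x ⟩
      (2 × 1#) * x    ≈⟨ *-congʳ 2×1≈0 ⟩
      0# * x          ≈⟨ zeroˡ x ⟩
      0#              ∎

    odd×1≈1 : ∀ n → ¬ 2 ∣ n → n × 1# ≈ 1#
    odd×1≈1 ℕ.zero            2∤0     = contradiction (2 ∣0) 2∤0
    odd×1≈1 (ℕ.suc ℕ.zero)    _       = ×-homo-1 1#
    odd×1≈1 (ℕ.suc (ℕ.suc n)) 2∤[2+n] = begin
      (2 ℕ.+ n) × 1#     ≈⟨ ×-homo-+ 1# 2 n ⟩
      2 × 1# + n × 1#    ≈⟨ +-cong 2×1≈0 (odd×1≈1 n (2∤[2+n] ∘ ∣m∣n⇒∣m+n ∣-refl)) ⟩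
      0# + 1#            ≈⟨ +-identityˡ 1# ⟩
      1#                 ∎

    -x≈x : ∀ x → - x ≈ x
    -x≈x x = sym (+-inverseʳ-unique x x (x+x≈0 x))

    [x-y]^2≈x^2-y^2 : ∀ x y → (x - y) ^ 2 ≈ x ^ 2 - y ^ 2
    [x-y]^2≈x^2-y^2 x y = begin
      (x - y) ^ 2                        ≈⟨ ^-congˡ 2 (+-congˡ (-x≈x y)) ⟩
      (x + y) ^ 2                        ≈⟨ solve 2 (λ x y →
                                              (x :+ y) :^ 2 := (x :^ 2 :+ y :^ 2) :+ (x :* y :+ x :* y))
                                              refl x y ⟩
      (x ^ 2 + y ^ 2) + (x * y + x * y)  ≈⟨ +-congˡ (x+x≈0 (x * y)) ⟩
      (x ^ 2 + y ^ 2) + 0#               ≈⟨ +-identityʳ _ ⟩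
      x ^ 2 + y ^ 2                      ≈⟨ +-congˡ (-x≈x (y ^ 2)) ⟨
      x ^ 2 - y ^ 2                      ∎

  2×1≉0⇒1≉-1 : ¬ 2 × 1# ≈ 0# → ¬ 1# ≈ - 1#
  2×1≉0⇒1≉-1 2×1≉0 1≈-1 = 2×1≉0 (begin
    2 × 1#    ≈⟨ +-congˡ (+-identityʳ 1#) ⟩
    1# + 1#   ≈⟨ +-congˡ 1≈-1 ⟩
    1# - 1#   ≈⟨ -‿inverseʳ 1# ⟩
    0#        ∎)

  module _ (isField : IsField R) where
    open IsField isField

    x≉0∧y≉0⇒x*y≉0 : ∀ {x y} → ¬ x ≈ 0# → ¬ y ≈ 0# → ¬ x * y ≈ 0#
    x≉0∧y≉0⇒x*y≉0 {x} {y} x≉0 y≉0 xy≈0 with inverse x x≉0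
    ... | x⁻¹ , x*x⁻¹≈1 = y≉0 (begin
      y               ≈⟨ *-identityˡ y ⟨
      1# * y          ≈⟨ *-congʳ x*x⁻¹≈1 ⟨
      (x * x⁻¹) * y   ≈⟨ solve 3 (λ x x⁻¹ y → (x :* x⁻¹) :* y := x⁻¹ :* (x :* y)) refl x x⁻¹ y ⟩
      x⁻¹ * (x * y)   ≈⟨ *-congˡ xy≈0 ⟩
      x⁻¹ * 0#        ≈⟨ zeroʳ x⁻¹ ⟩
      0#              ∎)

    -1≉0 : ¬ - 1# ≈ 0#
    -1≉0 -1≈0 = 1≉0 (begin
      1#        ≈⟨ -‿involutive 1# ⟨
      - - 1#    ≈⟨ -‿cong -1≈0 ⟩
      - 0#      ≈⟨ -0#≈0# ⟩
      0#        ∎)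

    x≉0⇒x^n≉0 : ∀ {x} → ¬ x ≈ 0# → ∀ n → ¬ x ^ n ≈ 0#
    x≉0⇒x^n≉0 x≉0 ℕ.zero    = 1≉0
    x≉0⇒x^n≉0 x≉0 (ℕ.suc n) = x≉0∧y≉0⇒x*y≉0 x≉0 (x≉0⇒x^n≉0 x≉0 n)

    module _ (2×1≈0 : 2 × 1# ≈ 0#) where

      x≉y⇒x^2≉y^2 : ∀ {x y} → ¬ x ≈ y → ¬ x ^ 2 ≈ y ^ 2
      x≉y⇒x^2≉y^2 {x} {y} x≉y x²≈y² = x≉0⇒x^n≉0 (x≉y ∘ x∙y⁻¹≈ε⇒x≈y x y) 2 (begin
        (x - y) ^ 2    ≈⟨ [x-y]^2≈x^2-y^2 2×1≈0 x y ⟩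
        x ^ 2 - y ^ 2  ≈⟨ x≈y⇒x∙y⁻¹≈ε x²≈y² ⟩
        0#             ∎)

      [y^2]^2-[x^2]^2≉0 : ∀ {x y} → ¬ x ≈ y → ¬ (y ^ 2) ^ 2 - (x ^ 2) ^ 2 ≈ 0#
      [y^2]^2-[x^2]^2≉0 {x} {y} x≉y =
        x≉y⇒x^2≉y^2 (x≉y⇒x^2≉y^2 (x≉y ∘ sym)) ∘ x∙y⁻¹≈ε⇒x≈y ((y ^ 2) ^ 2) ((x ^ 2) ^ 2)

      detM313sq≉0 : ∀ {a b d} → ¬ a ≈ b → ¬ a ≈ d → ¬ b ≈ d → ¬ detM313sq R a b d ≈ 0#
      detM313sq≉0 {a} {b} {d} a≉b a≉d b≉d det≈0 =
        x≉0∧y≉0⇒x*y≉0 ([y^2]^2-[x^2]^2≉0 a≉b)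
          (x≉0∧y≉0⇒x*y≉0 ([y^2]^2-[x^2]^2≉0 a≉d) ([y^2]^2-[x^2]^2≉0 b≉d))
          (trans (sym (det3-M313≈vandermonde (a ^ 2) (b ^ 2) (d ^ 2))) det≈0)

    module _ {n} (I : Inverse (≡.setoid (Fin n)) setoid) where

      card×1≈0 : n × 1# ≈ 0#
      card×1≈0 = card×x≈ε +-abelianGroup I 1#

      2∤card⇒2×1≉0 : ¬ 2 ∣ n → ¬ 2 × 1# ≈ 0#
      2∤card⇒2×1≉0 2∤n 2×1≈0 = 1≉0 (trans (sym (odd×1≈1 2×1≈0 n 2∤n)) card×1≈0)

      card≡2^e⇒¬¬2×1≈0 : ∀ e → n ≡.≡ 2 ℕ.^ e → ¬ ¬ 2 × 1# ≈ 0#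
      card≡2^e⇒¬¬2×1≈0 e ≡.refl 2×1≉0 =
        x≉0⇒x^n≉0 2×1≉0 e (trans (sym (×1-homo-^ 2 e)) card×1≈0)

open import Data.Nat using (_≤_; _^_)
open import Data.Product using (∃; _×_)
open import Relation.Binary.PropositionalEquality using (setoid)
open import Function.Bundles using (_⇔_; mk⇔)

lemma10 : ∀ {c ℓ} (F : CommutativeRing c ℓ) (p e : ℕ) → Prime p → 1 ≤ e
    → IsField F
    → Inverse (setoid (Fin (p ^ e))) (CommutativeRing.setoid F)
    → (∃ λ a → ∃ λ b → ∃ λ d →
    (¬ CommutativeRing._≈_ F a b) × (¬ CommutativeRing._≈_ F a d) × (¬ CommutativeRing._≈_ F b d)
    × CommutativeRing._≈_ F (detM313sq F a b d) (CommutativeRing.0# F))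
    ⇔ (¬ (2 ∣ p))
lemma10 F p e p-prime _ isField I = mk⇔
  (λ (a , b , d , a≉b , a≉d , b≉d , det≈0) 2∣p →
    card≡2^e⇒¬¬2×1≈0 F isField I e (≡.cong (_^ e) (2∣prime⇒≡2 p-prime 2∣p))
      (λ 2×1≈0 → detM313sq≉0 F isField 2×1≈0 a≉b a≉d b≉d det≈0))
  (λ 2∤p →
    1# , - 1# , 0# ,
    2×1≉0⇒1≉-1 F (2∤card⇒2×1≉0 F isField I (prime∤m⇒prime∤m^n prime[2] 2∤p e)) ,
    1≉0 , -1≉0 F isField , detM313sq[x,-x,y]≈0 F 1# 0#)
  where
  open CommutativeRing F using (1#; 0#; -_)
  open IsField isField using (1≉0)
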